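{- For every $n$ and $\epsilon>0$ we have $Q(n,\epsilon,5)<\epsilon^{ -2}$. That is, every graph $G=(V,E)$ with $n$ vertices and minimum degree at least $\epsilon n$ has an edge covering $E=E_1\cup\cdots\cup E_\ell$ with each $E_i$ of diameter at most $5$ and $\ell<\epsilon^{ -2}$.
   Context: The diameter of a connected graph is the maximum distance between two vertices ($\infty$ if disconnected); the diameter of an edge set $E'$ is the diameter of the graph with edge set $E'$ on the vertices covered by $E'$. $Q(n,\epsilon,d)$ is the minimum $\ell$ such that the edges of any graph on $n$ vertices with minimum degree at least $\epsilon n$ can be covered by $\ell$ edge sets each of diameter at most $d$.
   Formalization: The parameter ε ranges over the positive rationals. -}

module Defs where

open import Data.Nat using (ℕ; zero; suc; _+_; _≤_)
open import Data.Bool using (Bool; true; false)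
open import Data.Fin using (Fin)
open import Data.Vec using (count; allFin)
open import Data.Product using (Σ; ∃; _×_; _,_)
open import Relation.Binary.PropositionalEquality using (_≡_)
open import Relation.Nullary using (¬_)
open import Data.Bool.Properties using (T?)
open import Data.Bool using (T)

record EdgeSet (n : ℕ) : Set where
  field
    rel : Fin n → Fin n → Bool
    sym : ∀ u v → rel u v ≡ true → rel v u ≡ true
open EdgeSet public

record SimpleGraph (n : ℕ) : Set where
  field
    edges  : EdgeSet n
    irrefl : ∀ v → ¬ (rel edges v v ≡ true)
open SimpleGraph public

degree : ∀ {n} → SimpleGraph n → Fin n → ℕ
degree {n} G v = count (λ w → T? (rel (edges G) v w)) (allFin n)

data Walk {n : ℕ} (E : EdgeSet n) : Fin n → Fin n → ℕ → Set where
  here : ∀ v → Walk E v v zero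
  step : ∀ {u v w k} → rel E u v ≡ true → Walk E v w k → Walk E u w (suc k)

DistAtMost : ∀ {n} → EdgeSet n → Fin n → Fin n → ℕ → Set
DistAtMost E u w d = ∃ λ k → k ≤ d × Walk E u w k

Covered : ∀ {n} → EdgeSet n → Fin n → Set
Covered E v = ∃ λ w → rel E v w ≡ true

-- The graph with edge set E on the vertices covered by E has diameter ≤ d
-- (in particular it is connected; an empty edge set is vacuously fine).
DiamAtMost : ∀ {n} → EdgeSet n → ℕ → Set
DiamAtMost E d = ∀ u w → Covered E u → Covered E w → DistAtMost E u w d

_⊆ₑ_ : ∀ {n} → EdgeSet n → EdgeSet n → Set
E' ⊆ₑ E = ∀ u v → rel E' u v ≡ true → rel E u v ≡ true

CoversEdges : ∀ {n ℓ} → (Fin ℓ → EdgeSet n) → EdgeSet n → Set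
CoversEdges {ℓ = ℓ} Es E = ∀ u v → rel E u v ≡ true → ∃ λ (i : Fin ℓ) → rel (Es i) u v ≡ true

module Submission where

-- Greedily pick a maximal set S of vertices no two of which have a common neighbour. Their
-- neighbourhoods are disjoint, so |S| ⋅ εn ≤ n, i.e. |S| ≤ 1/ε; by maximality every non-isolated
-- vertex is at distance at most 2 from S. For s, t ∈ S let E_st be the set of edges lying on some
-- walk of length 5 from s to t. Any vertex covered by E_st sits on such a walk, at distance i from s
-- and 5 − i from t, so two covered vertices are within 5 of each other via s or via t. An edge uv
-- extends to a walk s ⋯ u v ⋯ t with s, t ∈ S at distance 2 from u and v, so the |S|(|S|+1)/2 sets
-- E_st cover E, and |S|(|S|+1)/2 ⋅ ε² < 1 because |S|ε ≤ 1 and ε < 1 (there are no loops).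

open import Defs
open import Data.Bool using (Bool; true; false)
open import Data.Bool.Properties using (T?) renaming (_≟_ to _≟ᵇ_)
open import Data.Empty using (⊥; ⊥-elim)
open import Data.Fin using (Fin) renaming (zero to fzero; _≟_ to _≟ᶠ_)
open import Data.Fin.Properties using (any?)
open import Data.Integer as ℤ using (+_; -[1+_])
import Data.Integer.Properties as ℤ
open import Data.List using (List; []; _∷_; _++_; map; length; lookup; allFin)
open import Data.List.Properties using (length-++; length-map)
open import Data.List.Membership.Propositional using (_∈_; find)
open import Data.List.Membership.Propositional.Properties using (∈-allFin; ∈-map⁺; ∈-++⁺ˡ; ∈-++⁺ʳ)
open import Data.List.Relation.Unary.All using (All; []; _∷_)
import Data.List.Relation.Unary.All as All
open import Data.List.Relation.Unary.All.Properties using (¬Any⇒All¬)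
open import Data.List.Relation.Unary.AllPairs using (AllPairs; []; _∷_)
import Data.List.Relation.Unary.AllPairs as AllPairs
open import Data.List.Relation.Unary.Any using (Any; here; there)
import Data.List.Relation.Unary.Any as Any
open import Data.List.Relation.Unary.Any.Properties using (lookup-index)
open import Data.Nat using (ℕ; zero; suc; _+_; _*_; _≤_; _<_; z≤n; s≤s; z<s; NonZero; >-nonZero)
open import Data.Nat.Coprimality using (Coprime)
open import Data.Nat.ListAction using (sum)
open import Data.Nat.Properties
open import Data.Nat.Tactic.RingSolver using (solve-∀)
open import Data.Product using (∃; ∃₂; _×_; _,_; uncurry)
open import Data.Rational as ℚ using (ℚ; mkℚ; 0ℚ; 1ℚ; _/_; toℚᵘ)
import Data.Rational.Properties as ℚ
import Data.Rational.Unnormalised as ℚᵘ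
import Data.Rational.Unnormalised.Properties as ℚᵘ
open import Data.Sum as Sum using (_⊎_; inj₁; inj₂)
open import Data.Vec as Vec using (Vec; countᵇ)
import Data.Vec.Membership.Propositional as Vec
open import Data.Vec.Membership.Propositional.Properties using (∈-allFin⁺)
import Data.Vec.Relation.Unary.Any as VecAny
open import Data.Vec.Properties using (count≤n)
open import Function using (_∘_)
open import Relation.Binary using (Decidable)
open import Relation.Binary.PropositionalEquality as ≡ using (_≡_; _≢_; refl; cong; trans; subst₂)
open import Relation.Nullary using (¬_; Dec; yes; no; does)
open import Relation.Nullary.Decidable using (map′; _×-dec_; _⊎-dec_; dec-true)

dec-true⁻¹ : ∀ {A : Set} (a? : Dec A) → does a? ≡ true → A
dec-true⁻¹ (yes a) _ = a

module _ {n : ℕ} {E : EdgeSet n} where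

  _▷_ : ∀ {u v w k} → Walk E u v k → rel E v w ≡ true → Walk E u w (suc k)
  here _   ▷ f = step f (here _)
  step e p ▷ f = step e (p ▷ f)

  _++ʷ_ : ∀ {u v w k m} → Walk E u v k → Walk E v w m → Walk E u w (k + m)
  here _   ++ʷ q = q
  step e p ++ʷ q = step e (p ++ʷ q)

  reverseʷ : ∀ {u v k} → Walk E u v k → Walk E v u k
  reverseʷ (here v)           = here v
  reverseʷ (step {u} {v} e p) = reverseʷ p ▷ sym E u v e

OnWalk : ∀ {n} → EdgeSet n → ℕ → (s t x : Fin n) → Set
OnWalk E d s t x = ∃₂ λ i j → i + j ≡ d × Walk E s x i × Walk E x t j

+≡∧+≡⇒+≤ : ∀ {d} i i′ j j′ → i + i′ ≡ d → j + j′ ≡ d → i + j ≤ d ⊎ i′ + j′ ≤ d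
+≡∧+≡⇒+≤ i i′ j j′ refl j+j′≡d with i ≤? j′
... | yes i≤j′ = inj₁ (≤-trans (≤-trans (+-monoˡ-≤ j i≤j′) (≤-reflexive (+-comm j′ j)))
                              (≤-reflexive j+j′≡d))
... | no  i≰j′ = inj₂ (≤-trans (≤-reflexive (+-comm i′ j′)) (+-monoˡ-≤ i′ (<⇒≤ (≰⇒> i≰j′))))

onWalk⇒distAtMost : ∀ {n} {E : EdgeSet n} {d s t x z} →
  OnWalk E d s t x → OnWalk E d s t z → DistAtMost E x z d
onWalk⇒distAtMost (i , i′ , i+i′≡d , sx , xt) (j , j′ , j+j′≡d , sz , zt)
  with +≡∧+≡⇒+≤ i i′ j j′ i+i′≡d j+j′≡d
... | inj₁ i+j≤d   = i + j , i+j≤d , reverseʷ sx ++ʷ sz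
... | inj₂ i′+j′≤d = i′ + j′ , i′+j′≤d , xt ++ʷ reverseʷ zt

module WalkEdges {n : ℕ} (E : EdgeSet n) where

  private
    Adj : Fin n → Fin n → Set
    Adj u v = rel E u v ≡ true

    adj? : Decidable Adj
    adj? u v = rel E u v ≟ᵇ true

  walk? : ∀ k u v → Dec (Walk E u v k)
  walk? zero u v = map′ (λ { refl → here u }) (λ { (here _) → refl }) (u ≟ᶠ v)
  walk? (suc k) u v =
    map′ (λ (w , e , p) → step e p) (λ { (step e p) → _ , e , p })
         (any? λ w → adj? u w ×-dec walk? k w v)

  EdgeOnWalkAt : ℕ → (s t x y : Fin n) → ℕ → ℕ → Set
  EdgeOnWalkAt d s t x y i j = i + suc j ≡ d × Walk E s x i × Adj x y × Walk E y t j

  EdgeOnWalk : ℕ → (s t x y : Fin n) → Set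
  EdgeOnWalk d s t x y = ∃₂ (EdgeOnWalkAt d s t x y)

  edgeOnWalk? : ∀ d s t x y → Dec (EdgeOnWalk d s t x y)
  edgeOnWalk? d s t x y =
    map′ (λ (i , _ , j , _ , w) → i , j , w) bounded
         (anyUpTo? (λ i → anyUpTo? (λ j →
            (i + suc j ≟ d) ×-dec walk? i s x ×-dec adj? x y ×-dec walk? j y t) d) d)
    where
    bounded : EdgeOnWalk d s t x y → ∃ λ i → i < d × ∃ λ j → j < d × EdgeOnWalkAt d s t x y i j
    bounded (i , j , w@(refl , _)) = i , m<m+n i z<s , j , m≤n+m (suc j) i , w

  private
    walkEdge? : ∀ d s t x y → Dec (EdgeOnWalk d s t x y ⊎ EdgeOnWalk d s t y x)
    walkEdge? d s t x y = edgeOnWalk? d s t x y ⊎-dec edgeOnWalk? d s t y x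

  -- Opaque so that the type checker never unfolds the decision procedure behind rel.
  opaque
    walkEdges : ℕ → Fin n → Fin n → EdgeSet n
    rel (walkEdges d s t) x y = does (walkEdge? d s t x y)
    sym (walkEdges d s t) x y h =
      dec-true (walkEdge? d s t y x) (Sum.swap (dec-true⁻¹ (walkEdge? d s t x y) h))

    edgeOnWalk⇒walkEdge : ∀ {d s t x y} → EdgeOnWalk d s t x y ⊎ EdgeOnWalk d s t y x →
      rel (walkEdges d s t) x y ≡ true
    edgeOnWalk⇒walkEdge {d} {s} {t} {x} {y} = dec-true (walkEdge? d s t x y)

    walkEdge⇒edgeOnWalk : ∀ {d s t x y} → rel (walkEdges d s t) x y ≡ true →
      EdgeOnWalk d s t x y ⊎ EdgeOnWalk d s t y x
    walkEdge⇒edgeOnWalk {d} {s} {t} {x} {y} = dec-true⁻¹ (walkEdge? d s t x y)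

  walkEdges⊆ : ∀ d s t → walkEdges d s t ⊆ₑ E
  walkEdges⊆ d s t x y h with walkEdge⇒edgeOnWalk h
  ... | inj₁ (_ , _ , _ , _ , e , _) = e
  ... | inj₂ (_ , _ , _ , _ , e , _) = sym E y x e

  covered⇒onWalk : ∀ {d s t x} → Covered (walkEdges d s t) x → OnWalk E d s t x
  covered⇒onWalk (y , h) with walkEdge⇒edgeOnWalk h
  ... | inj₁ (i , j , eq , sx , e , yt) = i , suc j , eq , sx , step e yt
  ... | inj₂ (i , j , eq , sy , e , xt) = suc i , j , trans (≡.sym (+-suc i j)) eq , sy ▷ e , xt

  walk⇒walkEdges : ∀ {d s t u v a b c} → Walk E s u a → (p : Walk E u v b) → Walk E v t c →
    a + (b + c) ≡ d → Walk (walkEdges d s t) u v b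
  walk⇒walkEdges r (here u)   q eq = here u
  walk⇒walkEdges {a = a} r (step e p) q eq =
    step (edgeOnWalk⇒walkEdge (inj₁ (a , _ , eq , r , e , p ++ʷ q)))
         (walk⇒walkEdges (r ▷ e) p q (trans (≡.sym (+-suc a _)) eq))

  onWalk⇒onWalk-walkEdges : ∀ {d s t x} → OnWalk E d s t x → OnWalk (walkEdges d s t) d s t x
  onWalk⇒onWalk-walkEdges {s = s} {t} (i , j , eq , sx , xt) =
    i , j , eq , walk⇒walkEdges (here s) sx xt eq ,
    walk⇒walkEdges sx xt (here t) (trans (cong (_+_ i) (+-identityʳ j)) eq)

  walkEdges-diam : ∀ d s t → DiamAtMost (walkEdges d s t) d
  walkEdges-diam d s t x z cx cz =
    onWalk⇒distAtMost (onWalk⇒onWalk-walkEdges (covered⇒onWalk cx))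
                      (onWalk⇒onWalk-walkEdges (covered⇒onWalk cz))

module _ {A : Set} {R : A → A → Set} (R? : Decidable R) where

  greedy : List A → List A
  greedy []       = []
  greedy (x ∷ xs) with Any.any? (R? x) (greedy xs)
  ... | yes _ = greedy xs
  ... | no  _ = x ∷ greedy xs

  greedy-independent : ∀ xs → AllPairs (λ x y → ¬ R x y) (greedy xs)
  greedy-independent []       = []
  greedy-independent (x ∷ xs) with Any.any? (R? x) (greedy xs)
  ... | yes _  = greedy-independent xs
  ... | no  ¬R = ¬Any⇒All¬ _ ¬R ∷ greedy-independent xs

  greedy-dominating : ∀ {u} xs → u ∈ xs → u ∈ greedy xs ⊎ Any (R u) (greedy xs)
  greedy-dominating (x ∷ xs) u∈ with Any.any? (R? x) (greedy xs) | u∈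
  ... | yes Rx | here refl  = inj₂ Rx
  ... | no  _  | here refl  = inj₁ (here refl)
  ... | yes _  | there u∈xs = greedy-dominating xs u∈xs
  ... | no  _  | there u∈xs = Sum.map there there (greedy-dominating xs u∈xs)

module _ {A B : Set} (N : B → A → Bool) where

  Disjoint : B → B → Set
  Disjoint s t = ∀ x → N s x ≡ true → N t x ≡ true → ⊥

  private
    Σcount : List B → ∀ {m} → Vec A m → ℕ
    Σcount S xs = sum (map (λ s → countᵇ (N s) xs) S)

    Σcount-[] : ∀ S → Σcount S Vec.[] ≡ 0
    Σcount-[] []      = refl
    Σcount-[] (_ ∷ S) = Σcount-[] S

    Σcount-∷-∉ : ∀ {x m} (xs : Vec A m) S → All (λ s → N s x ≢ true) S →
      Σcount S (x Vec.∷ xs) ≡ Σcount S xs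
    Σcount-∷-∉ xs []      []         = refl
    Σcount-∷-∉ {x} xs (s ∷ S) (x∉s ∷ x∉S) with N s x
    ... | true  = ⊥-elim (x∉s refl)
    ... | false = cong (_+_ (countᵇ (N s) xs)) (Σcount-∷-∉ xs S x∉S)

    Σcount-∷ : ∀ {x m} (xs : Vec A m) {S} → AllPairs Disjoint S →
      Σcount S (x Vec.∷ xs) ≤ suc (Σcount S xs)
    Σcount-∷ xs {[]} [] = z≤n
    Σcount-∷ {x} xs {s ∷ S} (s#S ∷ S#) with N s x in Nsx
    ... | true  = ≤-reflexive (cong (suc ∘ _+_ (countᵇ (N s) xs))
                    (Σcount-∷-∉ xs S (All.map (λ s#t Ntx → s#t x Nsx Ntx) s#S)))
    ... | false = ≤-trans (+-monoʳ-≤ (countᵇ (N s) xs) (Σcount-∷ xs S#)) (≤-reflexive (+-suc _ _))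

  sum-countᵇ-disjoint : ∀ {S} → AllPairs Disjoint S → ∀ {m} (xs : Vec A m) →
    sum (map (λ s → countᵇ (N s) xs) S) ≤ m
  sum-countᵇ-disjoint {S} S# Vec.[]       = ≤-reflexive (Σcount-[] S)
  sum-countᵇ-disjoint     S# (x Vec.∷ xs) =
    ≤-trans (Σcount-∷ xs S#) (s≤s (sum-countᵇ-disjoint S# xs))

countᵇ<length : ∀ {A : Set} (p : A → Bool) {x m} {xs : Vec A m} →
  x Vec.∈ xs → p x ≡ false → countᵇ p xs < m
countᵇ<length p {xs = _ Vec.∷ xs} (VecAny.here refl) px≡false rewrite px≡false =
  s≤s (count≤n (T? ∘ p) xs)
countᵇ<length p {xs = y Vec.∷ _} (VecAny.there x∈xs) px≡false with p y
... | true  = s≤s (countᵇ<length p x∈xs px≡false)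
... | false = m≤n⇒m≤1+n (countᵇ<length p x∈xs px≡false)

length*-≤-sum* : ∀ {A : Set} (f : A → ℕ) {c q} xs → (∀ x → c ≤ f x * q) →
  length xs * c ≤ sum (map f xs) * q
length*-≤-sum* f []       _ = z≤n
length*-≤-sum* f {c} {q} (x ∷ xs) c≤fq = begin
  c + length xs * c               ≤⟨ +-mono-≤ (c≤fq x) (length*-≤-sum* f xs c≤fq) ⟩
  f x * q + sum (map f xs) * q    ≡⟨ *-distribʳ-+ q (f x) _ ⟨
  (f x + sum (map f xs)) * q      ∎
  where open ≤-Reasoning

pairs : ∀ {A : Set} → List A → List (A × A)
pairs []       = []
pairs (x ∷ xs) = map (x ,_) (x ∷ xs) ++ pairs xs

pairs-complete : ∀ {A : Set} {s t : A} {xs} → s ∈ xs → t ∈ xs →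
  (s , t) ∈ pairs xs ⊎ (t , s) ∈ pairs xs
pairs-complete {xs = x ∷ _} (here refl) t∈         = inj₁ (∈-++⁺ˡ (∈-map⁺ (x ,_) t∈))
pairs-complete {xs = x ∷ _} (there s∈) (here refl) = inj₂ (∈-++⁺ˡ (∈-map⁺ (x ,_) (there s∈)))
pairs-complete {xs = x ∷ xs} (there s∈) (there t∈) =
  Sum.map (∈-++⁺ʳ (map (x ,_) (x ∷ xs))) (∈-++⁺ʳ _) (pairs-complete s∈ t∈)

length-pairs : ∀ {A : Set} (xs : List A) → 2 * length (pairs xs) ≡ length xs * suc (length xs)
length-pairs []       = refl
length-pairs (x ∷ xs) = begin
  2 * length (map (x ,_) (x ∷ xs) ++ pairs xs)
    ≡⟨ cong (2 *_) (trans (length-++ (map (x ,_) (x ∷ xs)))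
                          (cong (_+ length (pairs xs)) (length-map (x ,_) (x ∷ xs)))) ⟩
  2 * (suc k + length (pairs xs))     ≡⟨ *-distribˡ-+ 2 (suc k) _ ⟩
  2 * suc k + 2 * length (pairs xs)   ≡⟨ cong (_+_ (2 * suc k)) (length-pairs xs) ⟩
  2 * suc k + k * suc k               ≡⟨ *-distribʳ-+ (suc k) 2 k ⟨
  suc (suc k) * suc k                 ≡⟨ *-comm (suc (suc k)) (suc k) ⟩
  suc k * suc (suc k)                 ∎
  where
  open ≡.≡-Reasoning
  k = length xs

-- With ε = p/q: (k(k+1)/2) ε² = ((kε)² + kε ⋅ ε)/2 < (1 + 1)/2 when kε ≤ 1 and ε < 1.
triangular-bound : ∀ k ℓ {p q} → 2 * ℓ ≡ k * suc k → k * p ≤ q → p < q → ℓ * (p * p) < q * q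
triangular-bound k ℓ {p} {q} 2ℓ≡k[k+1] kp≤q p<q = *-cancelˡ-< 2 _ _ (begin-strict
  2 * (ℓ * (p * p))                 ≡⟨ *-assoc 2 ℓ (p * p) ⟨
  2 * ℓ * (p * p)                   ≡⟨ cong (_* (p * p)) 2ℓ≡k[k+1] ⟩
  k * suc k * (p * p)               ≡⟨ expand k p ⟩
  k * p * (k * p) + k * p * p       ≤⟨ +-mono-≤ (*-mono-≤ kp≤q kp≤q) (*-monoˡ-≤ p kp≤q) ⟩
  q * q + q * p                     <⟨ +-monoʳ-< (q * q) (*-monoʳ-< q p<q) ⟩
  q * q + q * q                     ≡⟨ double (q * q) ⟩
  2 * (q * q)                       ∎)
  where
  open ≤-Reasoning
  instance
    q≢0 : NonZero q
    q≢0 = >-nonZero (≤-<-trans z≤n p<q)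
  expand : ∀ k p → k * suc k * (p * p) ≡ k * p * (k * p) + k * p * p
  expand = solve-∀
  double : ∀ x → x + x ≡ 2 * x
  double = solve-∀

module _ (p q-1 : ℕ) .(c : Coprime p (suc q-1)) where

  private
    ε : ℚ
    ε = mkℚ (+ p) q-1 c

    q : ℕ
    q = suc q-1

    ℕ→ℚᵘ : ∀ m → toℚᵘ (+ m / 1) ℚᵘ.≃ ℚᵘ.mkℚᵘ (+ m) 0
    ℕ→ℚᵘ m = ℚ.toℚᵘ-fromℚᵘ (ℚᵘ.mkℚᵘ (+ m) 0)

  p/q*m≤k⇒p*m≤k*q : ∀ m k → ε ℚ.* (+ m / 1) ℚ.≤ + k / 1 → p * m ≤ k * q
  p/q*m≤k⇒p*m≤k*q m k ε*m≤k with ℚᵘ.≤-respʳ-≃ (ℕ→ℚᵘ k) (ℚᵘ.≤-respˡ-≃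
      (ℚᵘ.≃-trans (ℚ.toℚᵘ-homo-* ε (+ m / 1)) (ℚᵘ.*-congˡ {ℚᵘ.mkℚᵘ (+ p) q-1} (ℕ→ℚᵘ m)))
      (ℚ.toℚᵘ-mono-≤ ε*m≤k))
  ... | ℚᵘ.*≤* pm≤kq = ℤ.drop‿+≤+ (subst₂ ℤ._≤_ lhs rhs pm≤kq)
    where
    pm : ℚᵘ.ℚᵘ
    pm = ℚᵘ.mkℚᵘ (+ p) q-1 ℚᵘ.* ℚᵘ.mkℚᵘ (+ m) 0
    lhs : ℚᵘ.↥ pm ℤ.* + 1 ≡ + (p * m)
    lhs = trans (ℤ.*-identityʳ _) (ℤ.+◃n≡+n (p * m))
    rhs : + k ℤ.* ℚᵘ.↧ pm ≡ + (k * q)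
    rhs = trans (≡.sym (ℤ.pos-* k _)) (cong (λ d → + (k * suc d)) (*-identityʳ q-1))

  ℓ*p*p<q*q⇒ℓ*[p/q]²<1 : ∀ ℓ → ℓ * (p * p) < q * q → (+ ℓ / 1) ℚ.* (ε ℚ.* ε) ℚ.< 1ℚ
  ℓ*p*p<q*q⇒ℓ*[p/q]²<1 ℓ ℓp²<q² =
    ℚ.toℚᵘ-cancel-< (ℚᵘ.<-respˡ-≃ (ℚᵘ.≃-sym toℚᵘ-ℓε²) (ℚᵘ.*<* (subst₂ ℤ._<_ lhs rhs (ℤ.+<+ ℓp²<q²))))
    where
    ℓε² : ℚᵘ.ℚᵘ
    ℓε² = ℚᵘ.mkℚᵘ (+ ℓ) 0 ℚᵘ.* (toℚᵘ ε ℚᵘ.* toℚᵘ ε)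
    toℚᵘ-ℓε² : toℚᵘ ((+ ℓ / 1) ℚ.* (ε ℚ.* ε)) ℚᵘ.≃ ℓε²
    toℚᵘ-ℓε² =
      ℚᵘ.≃-trans (ℚ.toℚᵘ-homo-* (+ ℓ / 1) (ε ℚ.* ε)) (ℚᵘ.*-cong (ℕ→ℚᵘ ℓ) (ℚ.toℚᵘ-homo-* ε ε))
    lhs : + (ℓ * (p * p)) ≡ ℚᵘ.↥ ℓε² ℤ.* + 1
    lhs = ≡.sym (trans (ℤ.*-identityʳ _)
                (trans (cong (ℤ._*_ (+ ℓ)) (≡.sym (ℤ.pos-* p p))) (≡.sym (ℤ.pos-* ℓ (p * p)))))
    rhs : + (q * q) ≡ + 1 ℤ.* ℚᵘ.↧ ℓε²
    rhs = ≡.sym (trans (ℤ.*-identityˡ _) (cong (λ d → + suc d) (+-identityʳ _)))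

module Centres {n : ℕ} (G : SimpleGraph n) where

  open WalkEdges (edges G)

  private
    E = edges G

    Adj : Fin n → Fin n → Set
    Adj u v = rel E u v ≡ true

  CommonNeighbour : Fin n → Fin n → Set
  CommonNeighbour u s = ∃ λ c → Adj u c × Adj s c

  commonNeighbour? : Decidable CommonNeighbour
  commonNeighbour? u s = any? λ c → (rel E u c ≟ᵇ true) ×-dec (rel E s c ≟ᵇ true)

  centres : List (Fin n)
  centres = greedy commonNeighbour? (allFin n)

  degree<n : ∀ v → degree G v < n
  degree<n v with rel E v v in Evv
  ... | true  = ⊥-elim (irrefl G v Evv)
  ... | false = countᵇ<length (rel E v) (∈-allFin⁺ v) Evv

  sum-degree-centres≤n : sum (map (degree G) centres) ≤ n
  sum-degree-centres≤n = sum-countᵇ-disjoint (rel E)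
    (AllPairs.map (λ ¬common w Euw Esw → ¬common (w , Euw , Esw))
                  (greedy-independent commonNeighbour? (allFin n)))
    (Vec.allFin n)

  centre-within-2 : ∀ {u v} → Adj u v → ∃ λ s → s ∈ centres × Walk E s u 2
  centre-within-2 {u} {v} uv with greedy-dominating commonNeighbour? (allFin n) (∈-allFin u)
  ... | inj₁ u∈ = u , u∈ , step uv (step (sym E u v uv) (here u))
  ... | inj₂ common with find common
  ...   | s , s∈ , c , uc , sc = s , s∈ , step sc (step (sym E u c uc) (here u))

  family : Fin (length (pairs centres)) → EdgeSet n
  family i = uncurry (walkEdges 5) (lookup (pairs centres) i)

  family-covers : CoversEdges family E
  family-covers u v uv with centre-within-2 uv | centre-within-2 (sym E u v uv)
  ... | s , s∈ , su | t , t∈ , tv = Any.index hit , lookup-index hit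
    where
    hit : Any (λ st → rel (uncurry (walkEdges 5) st) u v ≡ true) (pairs centres)
    hit with pairs-complete s∈ t∈
    ... | inj₁ st∈ = Any.map (λ { refl →
            edgeOnWalk⇒walkEdge (inj₁ (2 , 2 , refl , su , uv , reverseʷ tv)) }) st∈
    ... | inj₂ ts∈ = Any.map (λ { refl →
            edgeOnWalk⇒walkEdge (inj₂ (2 , 2 , refl , tv , sym E u v uv , reverseʷ su)) }) ts∈

  module _ (p q : ℕ) (p*n≤deg*q : ∀ v → p * n ≤ degree G v * q) where

    centres*p≤q : .{{NonZero n}} → length centres * p ≤ q
    centres*p≤q = *-cancelʳ-≤ _ _ n (begin
      length centres * p * n           ≡⟨ *-assoc (length centres) p n ⟩
      length centres * (p * n)         ≤⟨ length*-≤-sum* (degree G) centres p*n≤deg*q ⟩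
      sum (map (degree G) centres) * q ≤⟨ *-monoˡ-≤ q sum-degree-centres≤n ⟩
      n * q                            ≡⟨ *-comm n q ⟩
      q * n                            ∎)
      where open ≤-Reasoning

    p<q : .{{NonZero q}} → Fin n → p < q
    p<q v = *-cancelʳ-< n p q (begin-strict
      p * n           ≤⟨ p*n≤deg*q v ⟩
      degree G v * q  <⟨ *-monoˡ-< q (degree<n v) ⟩
      n * q           ≡⟨ *-comm n q ⟩
      q * n           ∎)
      where open ≤-Reasoning

lemma3p5 : (n : ℕ) (ε : ℚ) → 0ℚ ℚ.< ε → (G : SimpleGraph n) →
    (∀ v → ε ℚ.* ((+ n) / 1) ℚ.≤ (+ degree G v) / 1) →
    ∃ λ (ℓ : ℕ) → ∃ λ (Es : Fin ℓ → EdgeSet n) →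
      (∀ i → Es i ⊆ₑ edges G) × CoversEdges Es (edges G) ×
      (∀ i → DiamAtMost (Es i) 5) × ((+ ℓ) / 1) ℚ.* (ε ℚ.* ε) ℚ.< 1ℚ
lemma3p5 _ (mkℚ -[1+ _ ] _ _) (ℚ.*<* ()) _ _
-- Without vertices the degree condition is vacuous and ε may exceed 1; no edge set is needed.
lemma3p5 zero (mkℚ (+ p) q-1 c) _ _ _ =
  0 , (λ ()) , (λ ()) , (λ ()) , (λ ()) , ℓ*p*p<q*q⇒ℓ*[p/q]²<1 p q-1 c 0 (s≤s z≤n)
lemma3p5 n@(suc _) (mkℚ (+ p) q-1 c) _ G δ =
  ℓ , family , (λ _ → walkEdges⊆ 5 _ _) , family-covers , (λ _ → walkEdges-diam 5 _ _) ,
  ℓ*p*p<q*q⇒ℓ*[p/q]²<1 p q-1 c ℓ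
    (triangular-bound (length centres) ℓ (length-pairs centres)
                      (centres*p≤q p q δ′) (p<q p q δ′ fzero))
  where
  open WalkEdges (edges G)
  open Centres G
  ℓ q : ℕ
  ℓ = length (pairs centres)
  q = suc q-1
  δ′ : ∀ v → p * n ≤ degree G v * q
  δ′ v = p/q*m≤k⇒p*m≤k*q p q-1 c n (degree G v) (δ v)
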